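{- Let $k\ge 3$, $d\ge 1$ and $s\ge 0$ be integers and let $G$ be a $(k,2d+1,s)$-multipole of order $n$. Then $$n^2-M(k,2d+1)\,n+\frac{s(dk-2d-1)(k-1)^d+s}{(k-2)^2}\ \ge\ 0,$$ where $M(k,2d+1)=\frac{k(k-1)^d-2}{k-2}$.
   Context: A multipole is a finite graph in which, besides links (edges joining two distinct vertices), there may be semiedges (edges incident with only one vertex); its order is its number of vertices. Degree counts links and semiedges; $k$-regular means every vertex has degree $k$. The girth is the length of a shortest cycle (of links), $\infty$ if acyclic. A $(k,g,s)$-multipole is a $k$-regular multipole of girth at least $g$ with exactly $s$ semiedges. -}

module Defs where

open import Data.Nat using (ℕ; zero; suc; _+_; _*_; _∸_; _^_; _<_)
open import Data.Nat.DivMod using (_%_; m%n<n)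
open import Data.Fin using (Fin; toℕ; fromℕ<; _≟_)
open import Data.List using (List; length; filter; lookup)
open import Data.List.Relation.Unary.All using (All)
open import Data.Product using (_×_; _,_; proj₁; proj₂)
open import Data.Sum using (_⊎_)
open import Relation.Binary.PropositionalEquality using (_≡_; _≢_)
open import Relation.Nullary using (¬_)
open import Function.Definitions using (Injective)
open import Data.Integer as ℤ using (ℤ; +_)
open import Data.Rational using (ℚ; _/_)

-- A multipole of order n: vertices are Fin n; links are (unordered) pairs of
-- distinct vertices, stored as a list (parallel links are allowed a priori);
-- semiedges are recorded by the vertex they are incident with.
record Multipole (n : ℕ) : Set where
  field
    links     : List (Fin n × Fin n)
    loopless  : All (λ e → proj₁ e ≢ proj₂ e) links
    semiedges : List (Fin n)
open Multipole public

numSemiedges : ∀ {n} → Multipole n → ℕ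
numSemiedges G = length (semiedges G)

-- degree: links incident with v (each link has two distinct ends) plus semiedges at v
degree : ∀ {n} → Multipole n → Fin n → ℕ
degree G v =
  length (filter (λ e → v ≟ proj₁ e) (links G))
  + length (filter (λ e → v ≟ proj₂ e) (links G))
  + length (filter (λ w → v ≟ w) (semiedges G))

Regular : ∀ {n} → ℕ → Multipole n → Set
Regular k G = ∀ v → degree G v ≡ k

csuc : ∀ {m} → Fin (suc m) → Fin (suc m)
csuc {m} i = fromℕ< (m%n<n (suc (toℕ i)) (suc m))

Joins : ∀ {n} → Fin n × Fin n → Fin n → Fin n → Set
Joins e u w = (proj₁ e ≡ u × proj₂ e ≡ w) ⊎ (proj₁ e ≡ w × proj₂ e ≡ u)

-- a cycle of links of length (suc m): distinct vertices v_0..v_m and distinct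
-- links e_0..e_m with e_i joining v_i and v_{i+1 mod (m+1)}
record Cycle {n} (G : Multipole n) (m : ℕ) : Set where
  field
    vert     : Fin (suc m) → Fin n
    edge     : Fin (suc m) → Fin (length (links G))
    vertInj  : Injective _≡_ _≡_ vert
    edgeInj  : Injective _≡_ _≡_ edge
    adjacent : ∀ i → Joins (lookup (links G) (edge i)) (vert i) (vert (csuc i))

GirthAtLeast : ∀ {n} → ℕ → Multipole n → Set
GirthAtLeast g G = ∀ m → suc m < g → ¬ Cycle G m

IsKGSMultipole : ∀ {n} → ℕ → ℕ → ℕ → Multipole n → Set
IsKGSMultipole k g s G = Regular k G × GirthAtLeast g G × numSemiedges G ≡ s

-- Mkd k d = M(k,2d+1) = (k(k-1)^d - 2)/(k-2), for k ≥ 3 (value irrelevant for k < 3)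
Mkd : ℕ → ℕ → ℚ
Mkd (suc (suc (suc j))) d =
  ((+ (3 + j) ℤ.* (+ (2 + j)) ℤ.^ d) ℤ.- + 2) / suc j
Mkd _ _ = Data.Rational.0ℚ

T : ℕ → ℕ → ℕ → ℚ
T (suc (suc (suc j))) d s =
  (+ s ℤ.* ((+ (d * (3 + j)) ℤ.- + (2 * d) ℤ.- + 1) ℤ.* (+ (2 + j)) ℤ.^ d) ℤ.+ + s)
    / (suc j * suc j)
T _ _ _ = Data.Rational.0ℚ

module Submission where

-- Let x = k − 1 and count the non-backtracking walks of length at most d. Two such walks
-- with the same ends would contain a cycle of length at most 2d, so, the girth being larger,
-- there are at most n² of them. Counted by their first dart instead: a dart z can be preceded
-- by x − σ darts, σ the number of semiedges at the tail of z; there are k n − s darts, and a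
-- vertex carrying a semiedge has at most x links. By induction on the length this gives at
-- least M n − s Σ_{i<d} (i+1) xⁱ walks, where M = M(k, 2d+1) = 1 + k Σ_{i<d} xⁱ. The closed
-- forms (x − 1) Σ_{i<d} xⁱ = xᵈ − 1 and (x − 1)² Σ_{i<d} (i+1) xⁱ = d (x − 1) xᵈ − xᵈ + 1 turn
-- n² ≥ M n − s Σ_{i<d} (i+1) xⁱ into the stated inequality.

open import Defs
open import Data.Nat using (ℕ; _≤_; _+_; _*_)
open import Data.Integer using (+_)
open import Data.Rational using (ℚ; _/_; 0ℚ) renaming (_≤_ to _≤ℚ_; _+_ to _+ℚ_; _-_ to _-ℚ_; _*_ to _*ℚ_)

open import Algebra.Bundles using (Semiring)
open import Data.Empty using (⊥-elim)
open import Data.Fin using (Fin; zero; suc; _≟_; toℕ; fromℕ; inject₁; opposite)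
import Data.Fin.Properties as Fin
import Data.Fin.Relation.Unary.Top as Top
import Data.Integer as ℤ
open import Data.Integer using (0ℤ)
import Data.Integer.Properties as ℤₚ
import Data.Integer.Tactic.RingSolver as ℤ-Solver
open import Data.List as List using (List; []; _∷_; length; filter)
open import Data.List.Membership.Propositional.Properties using (∈-lookup)
import Data.List.Relation.Unary.All as ListAll
open import Data.Maybe using (Maybe; just; nothing)
open import Data.Nat using (zero; suc; _∸_; _^_; _<_; z≤n; s≤s; s≤s⁻¹; _≤?_)
open import Data.Nat.DivMod using (_%_; m%n<n; m<n⇒m%n≡m; n%n≡0)
open import Data.Nat.Properties hiding (_≟_)
open import Data.Nat.Tactic.RingSolver using (solve-∀)
open import Data.Product using (_×_; _,_; proj₁; proj₂; ∃; ∃₂)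
open import Data.Rational using (toℚᵘ)
open import Data.Rational.Properties
  using (toℚᵘ-cancel-≤; toℚᵘ-homo-+; toℚᵘ-homo-*; toℚᵘ-homo‿-; toℚᵘ-fromℚᵘ; fromℚᵘ-cong)
open import Data.Rational.Unnormalised as ℚᵘ using (ℚᵘ; mkℚᵘ; *≡*; *≤*)
import Data.Rational.Unnormalised.Properties as ℚᵘₚ
open import Data.Sum using (_⊎_; inj₁; inj₂)
open import Data.Unit using (⊤; tt)
open import Data.Vec as Vec using (Vec; []; _∷_; _∷ʳ_)
open import Data.Vec.Membership.Propositional using (_∈_; _∉_)
open import Data.Vec.Relation.Unary.All as All using (All; []; _∷_)
open import Data.Vec.Relation.Unary.Any using (here; there)
open import Data.Vec.Relation.Unary.Unique.Propositional using (Unique; []; _∷_)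
open import Data.Vec.Relation.Unary.Unique.Propositional.Properties using (lookup-injective)
open import Function using (_∘_)
open import Function.Definitions using (Injective)
open import Relation.Binary.PropositionalEquality
open import Relation.Nullary using (yes; no)

open Semiring +-*-semiring using (+-congˡ)
open import Algebra.Properties.Semiring.Sum +-*-semiring
  using (sum; sum-syntax; sum-cong-≗; ∑-distrib-+; ∑-comm; *-distribˡ-sum; *-distribʳ-sum)

-- Finite sums

sum-const : ∀ n c → ∑[ i < n ] c ≡ n * c
sum-const zero    c = refl
sum-const (suc n) c = +-congˡ (sum-const n c)

sum-mono-≤ : ∀ {n} {f g : Fin n → ℕ} → (∀ i → f i ≤ g i) → sum f ≤ sum g
sum-mono-≤ {zero}  f≤g = z≤n
sum-mono-≤ {suc n} f≤g = +-mono-≤ (f≤g zero) (sum-mono-≤ (f≤g ∘ suc))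

1≤sum⇒∃ : ∀ {n} (f : Fin n → ℕ) → 1 ≤ sum f → ∃ λ i → 1 ≤ f i
1≤sum⇒∃ {suc n} f 1≤Σ with f zero in eq
... | suc _ = zero , subst (1 ≤_) (sym eq) (s≤s z≤n)
... | zero  with 1≤sum⇒∃ (f ∘ suc) 1≤Σ
...   | i , 1≤fi = suc i , 1≤fi

Mass≥2 : {A : Set} → (A → ℕ) → Set
Mass≥2 f = (∃ λ a → 2 ≤ f a) ⊎ (∃₂ λ a b → a ≢ b × 1 ≤ f a × 1 ≤ f b)

2≤sum⇒Mass≥2 : ∀ {n} (f : Fin n → ℕ) → 2 ≤ sum f → Mass≥2 f
2≤sum⇒Mass≥2 {suc n} f 2≤Σ with f zero in eq
... | suc (suc _) = inj₁ (zero , subst (2 ≤_) (sym eq) (s≤s (s≤s z≤n)))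
... | suc zero with 1≤sum⇒∃ (f ∘ suc) (s≤s⁻¹ 2≤Σ)
...   | i , 1≤fi = inj₂ (zero , suc i , (λ ()) , subst (1 ≤_) (sym eq) (s≤s z≤n) , 1≤fi)
2≤sum⇒Mass≥2 {suc n} f 2≤Σ | zero with 2≤sum⇒Mass≥2 (f ∘ suc) 2≤Σ
...   | inj₁ (i , 2≤fi) = inj₁ (suc i , 2≤fi)
...   | inj₂ (i , j , i≢j , 1≤fi , 1≤fj) = inj₂ (suc i , suc j , i≢j ∘ Fin.suc-injective , 1≤fi , 1≤fj)

δ : ∀ {n} → Fin n → Fin n → ℕ
δ zero    zero    = 1
δ zero    (suc _) = 0
δ (suc _) zero    = 0
δ (suc i) (suc j) = δ i j

δ-refl : ∀ {n} (i : Fin n) → δ i i ≡ 1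
δ-refl zero    = refl
δ-refl (suc i) = δ-refl i

δ-sym : ∀ {n} (i j : Fin n) → δ i j ≡ δ j i
δ-sym zero    zero    = refl
δ-sym zero    (suc j) = refl
δ-sym (suc i) zero    = refl
δ-sym (suc i) (suc j) = δ-sym i j

δ-≢ : ∀ {n} {i j : Fin n} → i ≢ j → δ i j ≡ 0
δ-≢ {i = zero}  {zero}  i≢j = ⊥-elim (i≢j refl)
δ-≢ {i = zero}  {suc j} i≢j = refl
δ-≢ {i = suc i} {zero}  i≢j = refl
δ-≢ {i = suc i} {suc j} i≢j = δ-≢ (i≢j ∘ cong suc)

δ≤1 : ∀ {n} (i j : Fin n) → δ i j ≤ 1
δ≤1 zero    zero    = ≤-refl
δ≤1 zero    (suc j) = z≤n
δ≤1 (suc i) zero    = z≤n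
δ≤1 (suc i) (suc j) = δ≤1 i j

1≤δ⇒≡ : ∀ {n} {i j : Fin n} → 1 ≤ δ i j → i ≡ j
1≤δ⇒≡ {i = zero}  {zero}  _   = refl
1≤δ⇒≡ {i = suc i} {suc j} 1≤δ = cong suc (1≤δ⇒≡ 1≤δ)

sum-δ : ∀ {n} (a : Fin n) (g : Fin n → ℕ) → ∑[ i < n ] (δ i a * g i) ≡ g a
sum-δ {suc n} zero g = begin
  g zero + 0 + ∑[ i < n ] 0  ≡⟨ cong₂ _+_ (+-identityʳ (g zero)) (sum-const n 0) ⟩
  g zero + n * 0             ≡⟨ +-congˡ (*-zeroʳ n) ⟩
  g zero + 0                 ≡⟨ +-identityʳ (g zero) ⟩
  g zero                     ∎
  where open ≡-Reasoning
sum-δ {suc n} (suc a) g = sum-δ a (g ∘ suc)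

sum-δ-const : ∀ {n} (a : Fin n) → ∑[ i < n ] δ i a ≡ 1
sum-δ-const a = trans (sum-cong-≗ (λ i → sym (*-identityʳ (δ i a)))) (sum-δ a (λ _ → 1))

sum-except : ∀ {n} (a : Fin n) (h : Fin n → ℕ) → ∑[ i < n ] ((1 ∸ δ i a) * h i) + h a ≡ sum h
sum-except {n} a h = begin
  sum off + h a              ≡⟨ +-congˡ (sum-δ a h) ⟨
  sum off + sum on           ≡⟨ ∑-distrib-+ off on ⟨
  ∑[ i < n ] (off i + on i)  ≡⟨ sum-cong-≗ complement ⟩
  sum h                      ∎
  where
  open ≡-Reasoning
  off on : Fin n → ℕ
  off i = (1 ∸ δ i a) * h i
  on  i = δ i a * h i
  complement : ∀ i → off i + on i ≡ h i
  complement i = begin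
    (1 ∸ δ i a) * h i + δ i a * h i  ≡⟨ *-distribʳ-+ (h i) (1 ∸ δ i a) (δ i a) ⟨
    (1 ∸ δ i a + δ i a) * h i        ≡⟨ cong (_* h i) (m∸n+n≡m (δ≤1 i a)) ⟩
    1 * h i                          ≡⟨ *-identityˡ (h i) ⟩
    h i                              ∎

length-filter-≟ : ∀ {n} {A : Set} (f : A → Fin n) (w : Fin n) (l : List A) →
                  length (filter (λ a → w ≟ f a) l) ≡ ∑[ i < length l ] δ (f (List.lookup l i)) w
length-filter-≟ f w []      = refl
length-filter-≟ f w (a ∷ l) with w ≟ f a
... | yes refl = cong₂ _+_ (sym (δ-refl w)) (length-filter-≟ f w l)
... | no w≢fa  = trans (length-filter-≟ f w l) (cong (_+ _) (sym (trans (δ-sym (f a) w) (δ-≢ w≢fa))))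

∑² : ∀ {a b} → (Fin a × Fin b → ℕ) → ℕ
∑² {a} {b} f = ∑[ i < a ] ∑[ j < b ] f (i , j)

module _ {a b : ℕ} where

  ∑²-cong : {f g : Fin a × Fin b → ℕ} → (∀ y → f y ≡ g y) → ∑² f ≡ ∑² g
  ∑²-cong f≗g = sum-cong-≗ (λ i → sum-cong-≗ (λ j → f≗g (i , j)))

  ∑²-mono-≤ : {f g : Fin a × Fin b → ℕ} → (∀ y → f y ≤ g y) → ∑² f ≤ ∑² g
  ∑²-mono-≤ f≤g = sum-mono-≤ (λ i → sum-mono-≤ (λ j → f≤g (i , j)))

  ∑²-distrib-+ : (f g : Fin a × Fin b → ℕ) → ∑² (λ y → f y + g y) ≡ ∑² f + ∑² g
  ∑²-distrib-+ f g =
    trans (sum-cong-≗ (λ i → ∑-distrib-+ (λ j → f (i , j)) (λ j → g (i , j))))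
          (∑-distrib-+ (λ i → ∑[ j < b ] f (i , j)) (λ i → ∑[ j < b ] g (i , j)))

  *-distribˡ-∑² : ∀ c (f : Fin a × Fin b → ℕ) → c * ∑² f ≡ ∑² (λ y → c * f y)
  *-distribˡ-∑² c f = trans (*-distribˡ-sum c (λ i → ∑[ j < b ] f (i , j)))
                            (sum-cong-≗ (λ i → *-distribˡ-sum c (λ j → f (i , j))))

  *-distribʳ-∑² : ∀ c (f : Fin a × Fin b → ℕ) → ∑² f * c ≡ ∑² (λ y → f y * c)
  *-distribʳ-∑² c f = trans (*-distribʳ-sum c (λ i → ∑[ j < b ] f (i , j)))
                            (sum-cong-≗ (λ i → *-distribʳ-sum c (λ j → f (i , j))))

  ∑²-comm-sum : ∀ {k} (h : Fin a × Fin b → Fin k → ℕ) →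
                ∑² (λ y → ∑[ w < k ] h y w) ≡ ∑[ w < k ] ∑² (λ y → h y w)
  ∑²-comm-sum h =
    trans (sum-cong-≗ (λ i → ∑-comm (λ j → h (i , j)))) (∑-comm (λ i w → ∑[ j < b ] h (i , j) w))

  ∑²-comm : (h : Fin a × Fin b → Fin a × Fin b → ℕ) →
            ∑² (λ y → ∑² (λ z → h y z)) ≡ ∑² (λ z → ∑² (λ y → h y z))
  ∑²-comm h = begin
    ∑² (λ y → ∑[ i < a ] ∑[ j < b ] h y (i , j))
      ≡⟨ ∑²-comm-sum (λ y i → ∑[ j < b ] h y (i , j)) ⟩
    ∑[ i < a ] ∑² (λ y → ∑[ j < b ] h y (i , j))
      ≡⟨ sum-cong-≗ (λ i → ∑²-comm-sum (λ y j → h y (i , j))) ⟩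
    ∑² (λ z → ∑² (λ y → h y z)) ∎
    where open ≡-Reasoning

  1≤∑²⇒∃ : (f : Fin a × Fin b → ℕ) → 1 ≤ ∑² f → ∃ λ y → 1 ≤ f y
  1≤∑²⇒∃ f 1≤Σ with 1≤sum⇒∃ _ 1≤Σ
  ... | i , 1≤Σi with 1≤sum⇒∃ _ 1≤Σi
  ...   | j , 1≤fij = (i , j) , 1≤fij

  2≤∑²⇒Mass≥2 : (f : Fin a × Fin b → ℕ) → 2 ≤ ∑² f → Mass≥2 f
  2≤∑²⇒Mass≥2 f 2≤Σ with 2≤sum⇒Mass≥2 _ 2≤Σ
  ... | inj₂ (i , i′ , i≢i′ , 1≤Σi , 1≤Σi′) with 1≤sum⇒∃ _ 1≤Σi | 1≤sum⇒∃ _ 1≤Σi′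
  ...   | j , 1≤fij | j′ , 1≤fij′ = inj₂ ((i , j) , (i′ , j′) , i≢i′ ∘ cong proj₁ , 1≤fij , 1≤fij′)
  2≤∑²⇒Mass≥2 f 2≤Σ | inj₁ (i , 2≤Σi) with 2≤sum⇒Mass≥2 _ 2≤Σi
  ... | inj₁ (j , 2≤fij) = inj₁ ((i , j) , 2≤fij)
  ... | inj₂ (j , j′ , j≢j′ , 1≤fij , 1≤fij′) =
    inj₂ ((i , j) , (i , j′) , j≢j′ ∘ cong proj₂ , 1≤fij , 1≤fij′)

1≤m+n⇒1≤m⊎1≤n : ∀ m {n} → 1 ≤ m + n → 1 ≤ m ⊎ 1 ≤ n
1≤m+n⇒1≤m⊎1≤n zero    1≤n = inj₂ 1≤n
1≤m+n⇒1≤m⊎1≤n (suc m) _   = inj₁ (s≤s z≤n)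

1≤m*n⇒1≤m×1≤n : ∀ m n → 1 ≤ m * n → 1 ≤ m × 1 ≤ n
1≤m*n⇒1≤m×1≤n (suc m) (suc n) _    = s≤s z≤n , s≤s z≤n
1≤m*n⇒1≤m×1≤n (suc m) zero 1≤m*0 with () ← subst (1 ≤_) (*-zeroʳ (suc m)) 1≤m*0

2≤m+n⇒1≤m×1≤n⊎2≤n : ∀ m {n} → m ≤ 1 → 2 ≤ m + n → (1 ≤ m × 1 ≤ n) ⊎ 2 ≤ n
2≤m+n⇒1≤m×1≤n⊎2≤n zero          _        2≤n       = inj₂ 2≤n
2≤m+n⇒1≤m×1≤n⊎2≤n (suc zero)    _        (s≤s 1≤n) = inj₁ (s≤s z≤n , 1≤n)
2≤m+n⇒1≤m×1≤n⊎2≤n (suc (suc m)) (s≤s ()) _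

2≤m*n⇒2≤n : ∀ m {n} → m ≤ 1 → 2 ≤ m * n → 2 ≤ n
2≤m*n⇒2≤n (suc zero)    {n} _        2≤n = subst (2 ≤_) (+-identityʳ n) 2≤n
2≤m*n⇒2≤n (suc (suc m))     (s≤s ()) _

m+n≡1+o⇒m*n≤o*n : ∀ m n {o} → m + n ≡ suc o → m * n ≤ o * n
m+n≡1+o⇒m*n≤o*n m zero    {o} _ = ≤-reflexive (trans (*-zeroʳ m) (sym (*-zeroʳ o)))
m+n≡1+o⇒m*n≤o*n m (suc n)     eq =
  *-monoˡ-≤ (suc n) (m+n≤o⇒m≤o m (≤-reflexive (suc-injective (trans (sym (+-suc m n)) eq))))

-- geometric x d = Σ_{i<d} xⁱ and arithmeticGeometric x d = Σ_{i<d} (i+1) xⁱ.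
geometric : ℕ → ℕ → ℕ
geometric x zero    = 0
geometric x (suc d) = 1 + x * geometric x d

arithmeticGeometric : ℕ → ℕ → ℕ
arithmeticGeometric x zero    = 0
arithmeticGeometric x (suc d) = x * arithmeticGeometric x d + x * geometric x d + 1

moore : ℕ → ℕ → ℕ
moore k d = 1 + k * geometric (k ∸ 1) d

geometric-closed : ∀ c d → c * geometric (suc c) d + 1 ≡ suc c ^ d
geometric-closed c zero    = cong (_+ 1) (*-zeroʳ c)
geometric-closed c (suc d) = begin
  c * (1 + suc c * geometric (suc c) d) + 1  ≡⟨ regroup c (geometric (suc c) d) ⟩
  suc c * (c * geometric (suc c) d + 1)      ≡⟨ cong (suc c *_) (geometric-closed c d) ⟩
  suc c * suc c ^ d                          ∎
  where
  open ≡-Reasoning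
  regroup : ∀ c g → c * (1 + suc c * g) + 1 ≡ suc c * (c * g + 1)
  regroup = solve-∀

arithmeticGeometric-closed : ∀ c d →
  c * c * arithmeticGeometric (suc c) d + suc c ^ d ≡ d * c * suc c ^ d + 1
arithmeticGeometric-closed c zero    = cong (_+ 1) (*-zeroʳ (c * c))
arithmeticGeometric-closed c (suc d) = begin
  c * c * (x * a + x * g + 1) + x * x ^ d
    ≡⟨ regroup c a g (x ^ d) ⟩
  x * (c * c * a + x ^ d) + (x * c * c * g + c * c)
    ≡⟨ cong (λ m → x * m + (x * c * c * g + c * c)) (arithmeticGeometric-closed c d) ⟩
  x * (d * c * x ^ d + 1) + (x * c * c * g + c * c)
    ≡⟨ cong (λ p → x * (d * c * p + 1) + (x * c * c * g + c * c)) (geometric-closed c d) ⟨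
  x * (d * c * (c * g + 1) + 1) + (x * c * c * g + c * c)
    ≡⟨ expand c d g ⟩
  suc d * c * (x * (c * g + 1)) + 1
    ≡⟨ cong (λ p → suc d * c * (x * p) + 1) (geometric-closed c d) ⟩
  suc d * c * (x * x ^ d) + 1 ∎
  where
  open ≡-Reasoning
  x a g : ℕ
  x = suc c
  a = arithmeticGeometric x d
  g = geometric x d
  regroup : ∀ c a g p → c * c * (suc c * a + suc c * g + 1) + suc c * p
                        ≡ suc c * (c * c * a + p) + (suc c * c * c * g + c * c)
  regroup = solve-∀
  expand : ∀ c d g → suc c * (d * c * (c * g + 1) + 1) + (suc c * c * c * g + c * c)
                     ≡ suc d * c * (suc c * (c * g + 1)) + 1
  expand = solve-∀

moore-closed : ∀ c d → (2 + c) * suc c ^ d ≡ c * moore (2 + c) d + 2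
moore-closed c d = begin
  (2 + c) * suc c ^ d                      ≡⟨ cong ((2 + c) *_) (geometric-closed c d) ⟨
  (2 + c) * (c * geometric (suc c) d + 1)  ≡⟨ regroup c (geometric (suc c) d) ⟩
  c * moore (2 + c) d + 2                  ∎
  where
  open ≡-Reasoning
  regroup : ∀ c g → (2 + c) * (c * g + 1) ≡ c * (1 + (2 + c) * g) + 2
  regroup = solve-∀

csuc-inject₁ : ∀ {t} (j : Fin t) → csuc (inject₁ j) ≡ suc j
csuc-inject₁ {t} j = Fin.toℕ-injective (begin
  toℕ (csuc (inject₁ j))         ≡⟨ Fin.toℕ-fromℕ< (m%n<n (suc (toℕ (inject₁ j))) (suc t)) ⟩
  suc (toℕ (inject₁ j)) % suc t  ≡⟨ cong (λ m → suc m % suc t) (Fin.toℕ-inject₁ j) ⟩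
  suc (toℕ j) % suc t            ≡⟨ m<n⇒m%n≡m (s≤s (Fin.toℕ<n j)) ⟩
  suc (toℕ j)                    ∎)
  where open ≡-Reasoning

csuc-fromℕ : ∀ t → csuc (fromℕ t) ≡ zero
csuc-fromℕ t = Fin.toℕ-injective (begin
  toℕ (csuc (fromℕ t))         ≡⟨ Fin.toℕ-fromℕ< (m%n<n (suc (toℕ (fromℕ t))) (suc t)) ⟩
  suc (toℕ (fromℕ t)) % suc t  ≡⟨ cong (λ m → suc m % suc t) (Fin.toℕ-fromℕ t) ⟩
  suc t % suc t                ≡⟨ n%n≡0 (suc t) ⟩
  0                            ∎)
  where open ≡-Reasoning

csuc²≢id : ∀ {t} (i : Fin (3 + t)) → csuc (csuc i) ≢ i
csuc²≢id i with Top.view i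
csuc²≢id {t} .(fromℕ (2 + t)) | Top.‵fromℕ
  rewrite csuc-fromℕ (2 + t) | csuc-inject₁ {2 + t} zero = λ ()
csuc²≢id {t} .(inject₁ j) | Top.‵inject₁ j with Top.view j
... | Top.‵fromℕ
  rewrite csuc-inject₁ (fromℕ (1 + t)) | csuc-fromℕ (2 + t) = λ ()
... | Top.‵inject₁ j′
  rewrite csuc-inject₁ (inject₁ j′) | csuc-inject₁ (suc j′) = λ eq → 2+n≢n (begin
    2 + toℕ j′                  ≡⟨ cong toℕ eq ⟩
    toℕ (inject₁ (inject₁ j′))  ≡⟨ Fin.toℕ-inject₁ (inject₁ j′) ⟩
    toℕ (inject₁ j′)            ≡⟨ Fin.toℕ-inject₁ j′ ⟩
    toℕ j′                      ∎)
  where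
  open ≡-Reasoning
  2+n≢n : ∀ {m} → 2 + m ≢ m
  2+n≢n {suc m} eq = 2+n≢n (suc-injective eq)

lookup-∷ʳ-inject₁ : ∀ {A : Set} {t} (xs : Vec A t) x (i : Fin t) →
                    Vec.lookup (xs ∷ʳ x) (inject₁ i) ≡ Vec.lookup xs i
lookup-∷ʳ-inject₁ (y ∷ xs) x zero    = refl
lookup-∷ʳ-inject₁ (y ∷ xs) x (suc i) = lookup-∷ʳ-inject₁ xs x i

lookup-∷ʳ-fromℕ : ∀ {A : Set} {t} (xs : Vec A t) x → Vec.lookup (xs ∷ʳ x) (fromℕ t) ≡ x
lookup-∷ʳ-fromℕ []       x = refl
lookup-∷ʳ-fromℕ (y ∷ xs) x = lookup-∷ʳ-fromℕ xs x

All≢⇒∉ : ∀ {A : Set} {t} {x : A} {xs : Vec A t} → All (x ≢_) xs → x ∉ xs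
All≢⇒∉ x≢xs x∈xs = All.lookup x≢xs x∈xs refl

∉⇒All≢ : ∀ {A : Set} {t} {x : A} {xs : Vec A t} → x ∉ xs → All (x ≢_) xs
∉⇒All≢ {xs = []}     _  = []
∉⇒All≢ {xs = y ∷ xs} x∉ = x∉ ∘ here ∷ ∉⇒All≢ (x∉ ∘ there)

joins-sym : ∀ {n} {e : Fin n × Fin n} {a b} → Joins e a b → Joins e b a
joins-sym (inj₁ (p , q)) = inj₂ (p , q)
joins-sym (inj₂ (p , q)) = inj₁ (p , q)

joins-same-link : ∀ {n} {e : Fin n × Fin n} {a b c d} → Joins e a b → Joins e c d →
                  a ≡ c ⊎ (a ≡ d × b ≡ c)
joins-same-link (inj₁ (p , q)) (inj₁ (p′ , q′)) = inj₁ (trans (sym p) p′)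
joins-same-link (inj₁ (p , q)) (inj₂ (p′ , q′)) = inj₂ (trans (sym p) p′ , trans (sym q) q′)
joins-same-link (inj₂ (p , q)) (inj₁ (p′ , q′)) = inj₂ (trans (sym q) q′ , trans (sym p) p′)
joins-same-link (inj₂ (p , q)) (inj₂ (p′ , q′)) = inj₁ (trans (sym q) q′)

-- Darts and degrees of a multipole

module _ {n : ℕ} (G : Multipole n) where

  open import Data.Vec.Membership.DecPropositional (_≟_ {n}) using (_∈?_)

  numLinks : ℕ
  numLinks = length (links G)

  Link : Set
  Link = Fin numLinks

  Dart : Set
  Dart = Link × Fin 2

  ends : Link → Fin n × Fin n
  ends = List.lookup (links G)

  link : Dart → Link
  link = proj₁

  source target : Dart → Fin n
  source (e , zero)     = proj₁ (ends e)
  source (e , suc zero) = proj₂ (ends e)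
  target (e , zero)     = proj₂ (ends e)
  target (e , suc zero) = proj₁ (ends e)

  reverse : Dart → Dart
  reverse (e , b) = e , opposite b

  source-reverse : ∀ y → source (reverse y) ≡ target y
  source-reverse (e , zero)     = refl
  source-reverse (e , suc zero) = refl

  target-reverse : ∀ y → target (reverse y) ≡ source y
  target-reverse (e , zero)     = refl
  target-reverse (e , suc zero) = refl

  ∑²-reverse : (f : Dart → ℕ) → ∑² (f ∘ reverse) ≡ ∑² f
  ∑²-reverse f = sum-cong-≗ (λ e → swap (f (e , suc zero)) (f (e , zero)))
    where
    swap : ∀ a b → a + (b + 0) ≡ b + (a + 0)
    swap = solve-∀

  numDarts : ℕ
  numDarts = ∑² {numLinks} {2} (λ _ → 1)

  ends-distinct : ∀ e → proj₁ (ends e) ≢ proj₂ (ends e)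
  ends-distinct e = ListAll.lookup (loopless G) (∈-lookup e)

  source≢target : ∀ y → source y ≢ target y
  source≢target (e , zero)     = ends-distinct e
  source≢target (e , suc zero) = ends-distinct e ∘ sym

  dart-joins : ∀ y → Joins (ends (link y)) (source y) (target y)
  dart-joins (e , zero)     = inj₁ (refl , refl)
  dart-joins (e , suc zero) = inj₂ (refl , refl)

  reverse-joins : ∀ {a} y → source y ≡ a → Joins (ends (link y)) (target y) a
  reverse-joins y refl = joins-sym (dart-joins y)

  linkDegree semiDegree : Fin n → ℕ
  linkDegree w = ∑² (λ y → δ (source y) w)
  semiDegree w = length (filter (w ≟_) (semiedges G))

  degree-split : ∀ w → linkDegree w + semiDegree w ≡ degree G w
  degree-split w = cong (_+ semiDegree w) (begin
    ∑[ e < numLinks ] (δ (proj₁ (ends e)) w + (δ (proj₂ (ends e)) w + 0))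
      ≡⟨ sum-cong-≗ (λ e → +-congˡ (+-identityʳ (δ (proj₂ (ends e)) w))) ⟩
    ∑[ e < numLinks ] (δ (proj₁ (ends e)) w + δ (proj₂ (ends e)) w)
      ≡⟨ ∑-distrib-+ (λ e → δ (proj₁ (ends e)) w) (λ e → δ (proj₂ (ends e)) w) ⟩
    ∑[ e < numLinks ] δ (proj₁ (ends e)) w + ∑[ e < numLinks ] δ (proj₂ (ends e)) w
      ≡⟨ cong₂ _+_ (length-filter-≟ proj₁ w (links G)) (length-filter-≟ proj₂ w (links G)) ⟨
    length (filter (λ e → w ≟ proj₁ e) (links G)) + length (filter (λ e → w ≟ proj₂ e) (links G)) ∎)
    where open ≡-Reasoning

  sum-semiDegree : ∑[ w < n ] semiDegree w ≡ numSemiedges G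
  sum-semiDegree = begin
    ∑[ w < n ] semiDegree w                      ≡⟨ sum-cong-≗ (λ w → length-filter-≟ (λ u → u) w semis) ⟩
    ∑[ w < n ] ∑[ i < length semis ] δ (at i) w  ≡⟨ ∑-comm (λ w i → δ (at i) w) ⟩
    ∑[ i < length semis ] ∑[ w < n ] δ (at i) w  ≡⟨ sum-cong-≗ (λ i → trans (sum-cong-≗ (δ-sym (at i)))
                                                                           (sum-δ-const (at i))) ⟩
    ∑[ i < length semis ] 1                      ≡⟨ sum-const (length semis) 1 ⟩
    length semis * 1                             ≡⟨ *-identityʳ (length semis) ⟩
    length semis                                 ∎
    where
    open ≡-Reasoning
    semis : List (Fin n)
    semis = semiedges G
    at : Fin (length semis) → Fin n
    at = List.lookup semis

  ∑²-source : (f : Fin n → ℕ) → ∑² (λ y → f (source y)) ≡ ∑[ w < n ] (linkDegree w * f w)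
  ∑²-source f = begin
    ∑² (λ y → f (source y))
      ≡⟨ ∑²-cong (λ y → sum-δ (source y) f) ⟨
    ∑² (λ y → ∑[ w < n ] (δ w (source y) * f w))
      ≡⟨ ∑²-comm-sum (λ y w → δ w (source y) * f w) ⟩
    ∑[ w < n ] ∑² (λ y → δ w (source y) * f w)
      ≡⟨ sum-cong-≗ (λ w → ∑²-cong (λ y → cong (_* f w) (δ-sym w (source y)))) ⟩
    ∑[ w < n ] ∑² (λ y → δ (source y) w * f w)
      ≡⟨ sum-cong-≗ (λ w → *-distribʳ-∑² (f w) (λ y → δ (source y) w)) ⟨
    ∑[ w < n ] (linkDegree w * f w) ∎
    where open ≡-Reasoning

  incidence : Fin n → Link → ℕ
  incidence w e = ∑[ b < 2 ] δ (source (e , b)) w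

  incidence-source : ∀ y → incidence (source y) (link y) ≡ 1
  incidence-source (e , zero)
    rewrite δ-refl (proj₁ (ends e)) | δ-≢ (ends-distinct e ∘ sym) = refl
  incidence-source (e , suc zero)
    rewrite δ-refl (proj₂ (ends e)) | δ-≢ (ends-distinct e) = refl

  incidence-target : ∀ y → incidence (target y) (link y) ≡ 1
  incidence-target y =
    trans (cong (λ w → incidence w (link y)) (sym (source-reverse y))) (incidence-source (reverse y))

  linkDegree-except : ∀ w e₀ →
    ∑² (λ y → (1 ∸ δ (link y) e₀) * δ (source y) w) + incidence w e₀ ≡ linkDegree w
  linkDegree-except w e₀ = begin
    ∑² (λ y → (1 ∸ δ (link y) e₀) * δ (source y) w) + incidence w e₀
      ≡⟨ cong (_+ incidence w e₀)
              (sum-cong-≗ (λ e → *-distribˡ-sum (1 ∸ δ e e₀) (λ b → δ (source (e , b)) w))) ⟨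
    ∑[ e < numLinks ] ((1 ∸ δ e e₀) * incidence w e) + incidence w e₀
      ≡⟨ sum-except e₀ (incidence w) ⟩
    linkDegree w ∎
    where open ≡-Reasoning

  -- Counting non-backtracking walks

  allowed : Maybe Link → Link → ℕ
  allowed nothing   e = 1
  allowed (just e₀) e = 1 ∸ δ e e₀

  step : Fin n → Maybe Link → Dart → ℕ
  step v p y = δ (source y) v * allowed p (link y)

  -- walks j v p counts the non-backtracking walks of length < j from v whose first link is
  -- not p, and walksTo j v p u those of them that end at u.
  walks : ℕ → Fin n → Maybe Link → ℕ
  walks zero    v p = 0
  walks (suc j) v p = 1 + ∑² (λ y → step v p y * walks j (target y) (just (link y)))

  walksTo : ℕ → Fin n → Maybe Link → Fin n → ℕ
  walksTo zero    v p u = 0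
  walksTo (suc j) v p u = δ v u + ∑² (λ y → step v p y * walksTo j (target y) (just (link y)) u)

  sum-walksTo : ∀ j v p → ∑[ u < n ] walksTo j v p u ≡ walks j v p
  sum-walksTo zero    v p = trans (sum-const n 0) (*-zeroʳ n)
  sum-walksTo (suc j) v p = begin
    ∑[ u < n ] (δ v u + ∑² (λ y → step v p y * next y u))
      ≡⟨ ∑-distrib-+ (δ v) (λ u → ∑² (λ y → step v p y * next y u)) ⟩
    ∑[ u < n ] δ v u + ∑[ u < n ] ∑² (λ y → step v p y * next y u)
      ≡⟨ cong₂ _+_ (trans (sum-cong-≗ (δ-sym v)) (sum-δ-const v))
                   (sym (∑²-comm-sum (λ y u → step v p y * next y u))) ⟩
    1 + ∑² (λ y → ∑[ u < n ] (step v p y * next y u))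
      ≡⟨ +-congˡ (∑²-cong (λ y → sym (*-distribˡ-sum (step v p y) (next y)))) ⟩
    1 + ∑² (λ y → step v p y * ∑[ u < n ] next y u)
      ≡⟨ +-congˡ (∑²-cong (λ y → cong (step v p y *_) (sum-walksTo j (target y) (just (link y))))) ⟩
    walks (suc j) v p ∎
    where
    open ≡-Reasoning
    next : Dart → Fin n → ℕ
    next y = walksTo j (target y) (just (link y))

  follows : Dart → Dart → ℕ
  follows y z = step (target y) (just (link y)) z

  walksAfter : ℕ → Dart → ℕ
  walksAfter j y = walks j (target y) (just (link y))

  dartWalks : ℕ → ℕ
  dartWalks j = ∑² (walksAfter j)

  successors+1≡linkDegree : ∀ y → ∑² (follows y) + 1 ≡ linkDegree (target y)
  successors+1≡linkDegree y = begin
    ∑² (follows y) + 1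
      ≡⟨ cong₂ _+_ (∑²-cong (λ z → *-comm (δ (source z) (target y)) (1 ∸ δ (link z) (link y))))
                   (sym (incidence-target y)) ⟩
    ∑² (λ z → (1 ∸ δ (link z) (link y)) * δ (source z) (target y)) + incidence (target y) (link y)
      ≡⟨ linkDegree-except (target y) (link y) ⟩
    linkDegree (target y) ∎
    where open ≡-Reasoning

  predecessors+1≡linkDegree : ∀ z → ∑² (λ y → follows y z) + 1 ≡ linkDegree (source z)
  predecessors+1≡linkDegree z = begin
    ∑² (λ y → follows y z) + 1
      ≡⟨ cong₂ _+_ (trans (sym (∑²-reverse (λ y → follows y z))) (∑²-cong reversed))
                   (sym (incidence-source z)) ⟩
    ∑² (λ y → (1 ∸ δ (link y) (link z)) * δ (source y) (source z)) + incidence (source z) (link z)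
      ≡⟨ linkDegree-except (source z) (link z) ⟩
    linkDegree (source z) ∎
    where
    open ≡-Reasoning
    reversed : ∀ y → follows (reverse y) z ≡ (1 ∸ δ (link y) (link z)) * δ (source y) (source z)
    reversed y rewrite target-reverse y | δ-sym (source z) (source y) | δ-sym (link z) (link y) =
      *-comm (δ (source y) (source z)) (1 ∸ δ (link y) (link z))

  sum-walks≡n+dartWalks : ∀ d → ∑[ v < n ] walks (suc d) v nothing ≡ n + dartWalks d
  sum-walks≡n+dartWalks d = begin
    ∑[ v < n ] (1 + ∑² (λ y → δ (source y) v * 1 * W y))
      ≡⟨ ∑-distrib-+ (λ _ → 1) (λ v → ∑² (λ y → δ (source y) v * 1 * W y)) ⟩
    ∑[ v < n ] 1 + ∑[ v < n ] ∑² (λ y → δ (source y) v * 1 * W y)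
      ≡⟨ cong₂ _+_ (trans (sum-const n 1) (*-identityʳ n))
                   (sym (∑²-comm-sum (λ y v → δ (source y) v * 1 * W y))) ⟩
    n + ∑² (λ y → ∑[ v < n ] (δ (source y) v * 1 * W y))
      ≡⟨ +-congˡ (∑²-cong (λ y → trans (sum-cong-≗ (λ v → cong (_* W y) (unit y v)))
                                       (sum-δ (source y) (λ _ → W y)))) ⟩
    n + dartWalks d ∎
    where
    open ≡-Reasoning
    W : Dart → ℕ
    W = walksAfter d
    unit : ∀ y v → δ (source y) v * 1 ≡ δ v (source y)
    unit y v = trans (*-identityʳ (δ (source y) v)) (δ-sym (source y) v)

  module _ {x : ℕ} (regular : Regular (suc x) G) where

    linkDegree+semiDegree : ∀ w → linkDegree w + semiDegree w ≡ suc x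
    linkDegree+semiDegree w = trans (degree-split w) (regular w)

    successors≤ : ∀ y → ∑² (follows y) ≤ x
    successors≤ y = s≤s⁻¹ (begin
      suc (∑² (follows y))                           ≡⟨ trans (+-comm 1 _) (successors+1≡linkDegree y) ⟩
      linkDegree (target y)                          ≤⟨ m≤m+n _ _ ⟩
      linkDegree (target y) + semiDegree (target y)  ≡⟨ linkDegree+semiDegree (target y) ⟩
      suc x                                          ∎)
      where open ≤-Reasoning

    predecessors+semiDegree : ∀ z → ∑² (λ y → follows y z) + semiDegree (source z) ≡ x
    predecessors+semiDegree z = suc-injective (trans
      (cong (_+ semiDegree (source z)) (trans (+-comm 1 _) (predecessors+1≡linkDegree z)))
      (linkDegree+semiDegree (source z)))

    walksAfter≤geometric : ∀ j y → walksAfter j y ≤ geometric x j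
    walksAfter≤geometric zero    y = z≤n
    walksAfter≤geometric (suc j) y = s≤s (begin
      ∑² (λ z → follows y z * walksAfter j z)
        ≤⟨ ∑²-mono-≤ (λ z → *-monoʳ-≤ (follows y z) (walksAfter≤geometric j z)) ⟩
      ∑² (λ z → follows y z * geometric x j)
        ≡⟨ *-distribʳ-∑² (geometric x j) (follows y) ⟨
      ∑² (follows y) * geometric x j
        ≤⟨ *-monoˡ-≤ (geometric x j) (successors≤ y) ⟩
      x * geometric x j ∎)
      where open ≤-Reasoning

    module _ {s : ℕ} (semiedgeCount : numSemiedges G ≡ s) where

      handshake : numDarts + s ≡ suc x * n
      handshake = begin
        numDarts + s
          ≡⟨ cong₂ _+_ (∑²-source (λ _ → 1)) (trans (sym semiedgeCount) (sym sum-semiDegree)) ⟩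
        ∑[ w < n ] (linkDegree w * 1) + ∑[ w < n ] semiDegree w
          ≡⟨ ∑-distrib-+ (λ w → linkDegree w * 1) semiDegree ⟨
        ∑[ w < n ] (linkDegree w * 1 + semiDegree w)
          ≡⟨ sum-cong-≗ (λ w → trans (cong (_+ semiDegree w) (*-identityʳ (linkDegree w)))
                                     (linkDegree+semiDegree w)) ⟩
        ∑[ w < n ] suc x
          ≡⟨ trans (sum-const n (suc x)) (*-comm n (suc x)) ⟩
        suc x * n ∎
        where open ≡-Reasoning

      ∑²-semiDegree-source≤ : ∑² (λ z → semiDegree (source z)) ≤ x * s
      ∑²-semiDegree-source≤ = begin
        ∑² (λ z → semiDegree (source z))
          ≡⟨ ∑²-source semiDegree ⟩
        ∑[ w < n ] (linkDegree w * semiDegree w)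
          ≤⟨ sum-mono-≤ (λ w → m+n≡1+o⇒m*n≤o*n (linkDegree w) (semiDegree w) (linkDegree+semiDegree w)) ⟩
        ∑[ w < n ] (x * semiDegree w)
          ≡⟨ *-distribˡ-sum x semiDegree ⟨
        x * ∑[ w < n ] semiDegree w
          ≡⟨ cong (x *_) (trans sum-semiDegree semiedgeCount) ⟩
        x * s ∎
        where open ≤-Reasoning

      dartWalks-suc : ∀ j →
        dartWalks (suc j) + ∑² (λ z → semiDegree (source z) * walksAfter j z) ≡ numDarts + x * dartWalks j
      dartWalks-suc j = begin
        ∑² (λ y → 1 + ∑² (λ z → follows y z * W z)) + ∑² (λ z → S z * W z)
          ≡⟨ cong (_+ ∑² (λ z → S z * W z))
                  (∑²-distrib-+ (λ _ → 1) (λ y → ∑² (λ z → follows y z * W z))) ⟩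
        numDarts + ∑² (λ y → ∑² (λ z → follows y z * W z)) + ∑² (λ z → S z * W z)
          ≡⟨ +-assoc numDarts _ _ ⟩
        numDarts + (∑² (λ y → ∑² (λ z → follows y z * W z)) + ∑² (λ z → S z * W z))
          ≡⟨ +-congˡ {numDarts} (cong (_+ ∑² (λ z → S z * W z)) by-predecessors) ⟩
        numDarts + (∑² (λ z → P z * W z) + ∑² (λ z → S z * W z))
          ≡⟨ +-congˡ (∑²-distrib-+ (λ z → P z * W z) (λ z → S z * W z)) ⟨
        numDarts + ∑² (λ z → P z * W z + S z * W z)
          ≡⟨ +-congˡ (∑²-cong (λ z → trans (sym (*-distribʳ-+ (W z) (P z) (S z)))
                                           (cong (_* W z) (predecessors+semiDegree z)))) ⟩
        numDarts + ∑² (λ z → x * W z)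
          ≡⟨ +-congˡ (*-distribˡ-∑² x W) ⟨
        numDarts + x * ∑² W ∎
        where
        open ≡-Reasoning
        W S P : Dart → ℕ
        W = walksAfter j
        S z = semiDegree (source z)
        P z = ∑² (λ y → follows y z)
        by-predecessors : ∑² (λ y → ∑² (λ z → follows y z * W z)) ≡ ∑² (λ z → P z * W z)
        by-predecessors = trans (∑²-comm (λ y z → follows y z * W z))
                                (∑²-cong (λ z → sym (*-distribʳ-∑² (W z) (λ y → follows y z))))

      dartWalks-lower : ∀ j → suc x * geometric x j * n ≤ dartWalks j + arithmeticGeometric x j * s
      dartWalks-lower zero    = ≤-trans (≤-reflexive (cong (_* n) (*-zeroʳ (suc x)))) z≤n
      dartWalks-lower (suc j) = begin
        suc x * geometric x (suc j) * n
          ≡⟨ unfold-geometric x g n ⟩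
        suc x * n + x * (suc x * g * n)
          ≤⟨ +-monoʳ-≤ (suc x * n) (*-monoʳ-≤ x (dartWalks-lower j)) ⟩
        suc x * n + x * (dartWalks j + a * s)
          ≡⟨ cong (_+ x * (dartWalks j + a * s)) handshake ⟨
        numDarts + s + x * (dartWalks j + a * s)
          ≡⟨ regroup numDarts s x (dartWalks j) a ⟩
        (numDarts + x * dartWalks j) + (x * a * s + s)
          ≡⟨ cong (_+ (x * a * s + s)) (dartWalks-suc j) ⟨
        dartWalks (suc j) + ∑² (λ z → semiDegree (source z) * walksAfter j z) + (x * a * s + s)
          ≤⟨ +-monoˡ-≤ (x * a * s + s) (+-monoʳ-≤ (dartWalks (suc j)) semiedge-loss) ⟩
        dartWalks (suc j) + x * s * g + (x * a * s + s)
          ≡⟨ fold-arithmeticGeometric (dartWalks (suc j)) x s g a ⟩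
        dartWalks (suc j) + arithmeticGeometric x (suc j) * s ∎
        where
        open ≤-Reasoning
        g a : ℕ
        g = geometric x j
        a = arithmeticGeometric x j
        semiedge-loss : ∑² (λ z → semiDegree (source z) * walksAfter j z) ≤ x * s * g
        semiedge-loss = begin
          ∑² (λ z → semiDegree (source z) * walksAfter j z)
            ≤⟨ ∑²-mono-≤ (λ z → *-monoʳ-≤ (semiDegree (source z)) (walksAfter≤geometric j z)) ⟩
          ∑² (λ z → semiDegree (source z) * g)
            ≡⟨ *-distribʳ-∑² g (λ z → semiDegree (source z)) ⟨
          ∑² (λ z → semiDegree (source z)) * g
            ≤⟨ *-monoˡ-≤ g ∑²-semiDegree-source≤ ⟩
          x * s * g ∎
        unfold-geometric : ∀ x g n → suc x * (1 + x * g) * n ≡ suc x * n + x * (suc x * g * n)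
        unfold-geometric = solve-∀
        regroup : ∀ D s x w a → D + s + x * (w + a * s) ≡ (D + x * w) + (x * a * s + s)
        regroup = solve-∀
        fold-arithmeticGeometric : ∀ w x s g a →
                                   w + x * s * g + (x * a * s + s) ≡ w + (x * a + x * g + 1) * s
        fold-arithmeticGeometric = solve-∀

  -- Short closed walks contain cycles

  Allowed : Maybe Link → Link → Set
  Allowed nothing   e = ⊤
  Allowed (just e₀) e = e ≢ e₀

  data Walk : Fin n → List Dart → Fin n → Set where
    []  : ∀ {a} → Walk a [] a
    _∷_ : ∀ {a y ds b} → source y ≡ a → Walk (target y) ds b → Walk a (y ∷ ds) b

  NonBacktracking : Maybe Link → List Dart → Set
  NonBacktracking p []       = ⊤
  NonBacktracking p (y ∷ ds) = Allowed p (link y) × NonBacktracking (just (link y)) ds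

  ClosedWalkWithin : ℕ → Set
  ClosedWalkWithin ℓ =
    ∃₂ λ a ds → Walk a ds a × NonBacktracking nothing ds × 1 ≤ length ds × length ds ≤ ℓ

  ClosedWalkWithin-mono : ∀ {ℓ ℓ′} → ℓ ≤ ℓ′ → ClosedWalkWithin ℓ → ClosedWalkWithin ℓ′
  ClosedWalkWithin-mono ℓ≤ℓ′ (a , ds , w , nb , nonempty , short) =
    a , ds , w , nb , nonempty , ≤-trans short ℓ≤ℓ′

  step≤1 : ∀ v p y → step v p y ≤ 1
  step≤1 v p y = *-mono-≤ (δ≤1 (source y) v) (allowed≤1 p)
    where
    allowed≤1 : ∀ p → allowed p (link y) ≤ 1
    allowed≤1 nothing   = ≤-refl
    allowed≤1 (just e₀) = m∸n≤m 1 (δ (link y) e₀)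

  1≤step⇒Allowed : ∀ v p y → 1 ≤ step v p y → source y ≡ v × Allowed p (link y)
  1≤step⇒Allowed v p y 1≤step with 1≤m*n⇒1≤m×1≤n (δ (source y) v) (allowed p (link y)) 1≤step
  ... | 1≤δ , 1≤allowed = 1≤δ⇒≡ 1≤δ , allowed⇒Allowed p 1≤allowed
    where
    allowed⇒Allowed : ∀ p → 1 ≤ allowed p (link y) → Allowed p (link y)
    allowed⇒Allowed nothing   _ = tt
    allowed⇒Allowed (just e₀) 1≤ refl with () ← subst (λ m → 1 ≤ 1 ∸ m) (δ-refl e₀) 1≤

  mutual
    1≤walksTo⇒Walk : ∀ j v p u → 1 ≤ walksTo j v p u →
                     ∃ λ ds → Walk v ds u × NonBacktracking p ds × length ds < j
    1≤walksTo⇒Walk (suc j) v p u 1≤ with 1≤m+n⇒1≤m⊎1≤n (δ v u) 1≤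
    ... | inj₁ 1≤δ = [] , subst (Walk v []) (1≤δ⇒≡ 1≤δ) [] , tt , s≤s z≤n
    ... | inj₂ 1≤Σ with 1≤∑²⇒∃ _ 1≤Σ
    ...   | y , 1≤term with 1≤term⇒Walk j v p u y 1≤term
    ...     | ds , w , nb , short = y ∷ ds , w , nb , s≤s short

    1≤term⇒Walk : ∀ j v p u y → 1 ≤ step v p y * walksTo j (target y) (just (link y)) u →
                  ∃ λ ds → Walk v (y ∷ ds) u × NonBacktracking p (y ∷ ds) × length ds < j
    1≤term⇒Walk j v p u y 1≤term with 1≤m*n⇒1≤m×1≤n (step v p y) _ 1≤term
    ... | 1≤step , 1≤rest
      with 1≤step⇒Allowed v p y 1≤step | 1≤walksTo⇒Walk j (target y) (just (link y)) u 1≤rest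
    ...   | src , ok | ds , w , nb , short = ds , src ∷ w , (ok , nb) , short

  reverseOnto : List Dart → List Dart → List Dart
  reverseOnto []       acc = acc
  reverseOnto (y ∷ ds) acc = reverseOnto ds (reverse y ∷ acc)

  length-reverseOnto : ∀ ds acc → length (reverseOnto ds acc) ≡ length ds + length acc
  length-reverseOnto []       acc = refl
  length-reverseOnto (y ∷ ds) acc =
    trans (length-reverseOnto ds (reverse y ∷ acc)) (+-suc (length ds) (length acc))

  walk-reverseOnto : ∀ {a b c ds acc} → Walk a ds b → Walk a acc c → Walk b (reverseOnto ds acc) c
  walk-reverseOnto []                                wacc = wacc
  walk-reverseOnto {c = c} {y ∷ ds} {acc} (src ∷ w) wacc = walk-reverseOnto w (source-reverse y ∷ wacc′)
    where
    wacc′ : Walk (target (reverse y)) acc c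
    wacc′ = subst (λ a → Walk a acc c) (sym (trans (target-reverse y) src)) wacc

  firstLink : List Dart → Maybe Link
  firstLink []      = nothing
  firstLink (y ∷ _) = just (link y)

  nonBacktracking-reverseOnto : ∀ ds acc → NonBacktracking (firstLink acc) ds → NonBacktracking nothing acc →
                                NonBacktracking nothing (reverseOnto ds acc)
  nonBacktracking-reverseOnto []       acc _            nb-acc = nb-acc
  nonBacktracking-reverseOnto (y ∷ ds) acc (ok , nb-ds) nb-acc =
    nonBacktracking-reverseOnto ds (reverse y ∷ acc) nb-ds (tt , prepend acc ok nb-acc)
    where
    prepend : ∀ acc → Allowed (firstLink acc) (link y) → NonBacktracking nothing acc →
              NonBacktracking (just (link y)) acc
    prepend []        _  _          = tt
    prepend (z ∷ acc) ok (_ , nb-z) = ok ∘ sym , nb-z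

  link-injective-at : ∀ {a} y z → source y ≡ a → source z ≡ a → link y ≡ link z → y ≡ z
  link-injective-at (e , zero)     (.e , zero)     _    _    refl = refl
  link-injective-at (e , suc zero) (.e , suc zero) _    _    refl = refl
  link-injective-at (e , zero)     (.e , suc zero) srcʸ srcᶻ refl =
    ⊥-elim (ends-distinct e (trans srcʸ (sym srcᶻ)))
  link-injective-at (e , suc zero) (.e , zero)     srcʸ srcᶻ refl =
    ⊥-elim (ends-distinct e (trans srcᶻ (sym srcʸ)))

  two-walks⇒closedWalk : ∀ {v u y z dsʸ dsᶻ} → y ≢ z →
    Walk v (y ∷ dsʸ) u → NonBacktracking (just (link y)) dsʸ →
    Walk v (z ∷ dsᶻ) u → NonBacktracking (just (link z)) dsᶻ →
    ClosedWalkWithin (suc (length dsᶻ) + suc (length dsʸ))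
  two-walks⇒closedWalk {u = u} {y} {z} {dsʸ} {dsᶻ} y≢z wʸ@(srcʸ ∷ _) nbʸ wᶻ@(srcᶻ ∷ _) nbᶻ =
    u , reverseOnto (z ∷ dsᶻ) (y ∷ dsʸ) ,
    walk-reverseOnto wᶻ wʸ ,
    nonBacktracking-reverseOnto (z ∷ dsᶻ) (y ∷ dsʸ)
      ((λ z≡y → y≢z (sym (link-injective-at z y srcᶻ srcʸ z≡y))) , nbᶻ) (tt , nbʸ) ,
    subst (1 ≤_) (sym (length-reverseOnto (z ∷ dsᶻ) (y ∷ dsʸ))) (s≤s z≤n) ,
    ≤-reflexive (length-reverseOnto (z ∷ dsᶻ) (y ∷ dsʸ))

  2≤walksTo⇒closedWalk : ∀ j v p u → 2 ≤ walksTo (suc j) v p u → ClosedWalkWithin (2 * j)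
  2≤walksTo⇒closedWalk j v p u 2≤ with 2≤m+n⇒1≤m×1≤n⊎2≤n (δ v u) (δ≤1 v u) 2≤
  ... | inj₁ (1≤δ , 1≤Σ) with 1≤∑²⇒∃ _ 1≤Σ
  ...   | y , 1≤term with 1≤term⇒Walk j v p u y 1≤term
  ...     | ds , w , (_ , nb) , short =
    v , y ∷ ds , subst (Walk v (y ∷ ds)) (sym (1≤δ⇒≡ 1≤δ)) w , (tt , nb) , s≤s z≤n ,
    ≤-trans short (m≤m+n j (j + 0))
  2≤walksTo⇒closedWalk j v p u 2≤ | inj₂ 2≤Σ with 2≤∑²⇒Mass≥2 _ 2≤Σ
  ... | inj₁ (y , 2≤term) = shorter j (2≤m*n⇒2≤n (step v p y) (step≤1 v p y) 2≤term)
    where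
    shorter : ∀ j → 2 ≤ walksTo j (target y) (just (link y)) u → ClosedWalkWithin (2 * j)
    shorter (suc j) 2≤′ = ClosedWalkWithin-mono (*-monoʳ-≤ 2 (n≤1+n j))
                                                (2≤walksTo⇒closedWalk j (target y) (just (link y)) u 2≤′)
  ... | inj₂ (y , z , y≢z , 1≤termʸ , 1≤termᶻ)
    with 1≤term⇒Walk j v p u y 1≤termʸ | 1≤term⇒Walk j v p u z 1≤termᶻ
  ...   | dsʸ , wʸ , (_ , nbʸ) , shortʸ | dsᶻ , wᶻ , (_ , nbᶻ) , shortᶻ =
    ClosedWalkWithin-mono (subst (suc (length dsᶻ) + suc (length dsʸ) ≤_) (+-congˡ {j} (sym (+-identityʳ j)))
                                 (+-mono-≤ shortᶻ shortʸ))
                          (two-walks⇒closedWalk y≢z wʸ nbʸ wᶻ nbᶻ)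

  cycle-links-injective : ∀ {t} (vert : Fin (3 + t) → Fin n) (edge : Fin (3 + t) → Link) →
    Injective _≡_ _≡_ vert → (∀ i → Joins (ends (edge i)) (vert i) (vert (csuc i))) → Injective _≡_ _≡_ edge
  cycle-links-injective vert edge vert-injective adjacent {i} {j} eq
    with joins-same-link (adjacent i)
                         (subst (λ e → Joins (ends e) (vert j) (vert (csuc j))) (sym eq) (adjacent j))
  ... | inj₁ vi≡vj            = vert-injective vi≡vj
  ... | inj₂ (vi≡vj⁺ , vi⁺≡vj) =
    ⊥-elim (csuc²≢id j (trans (cong csuc (sym (vert-injective vi≡vj⁺))) (vert-injective vi⁺≡vj)))

  data Path : ∀ {r} → Vec (Fin n) (suc r) → Vec Link r → Set where
    []  : ∀ {a} → Path (a ∷ []) []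
    _∷_ : ∀ {r a e} {vs : Vec (Fin n) (suc r)} {es} →
          Joins (ends e) a (Vec.head vs) → Path vs es → Path (a ∷ vs) (e ∷ es)

  path-joins : ∀ {r} {vs : Vec (Fin n) (suc r)} {es} → Path vs es →
    ∀ i → Joins (ends (Vec.lookup es i)) (Vec.lookup vs (inject₁ i)) (Vec.lookup vs (suc i))
  path-joins (_∷_ {vs = _ ∷ _} joins _) zero    = joins
  path-joins (_ ∷ path)                 (suc i) = path-joins path i

  closed-path-joins : ∀ {t a} {vs : Vec (Fin n) t} {es} f → Path (a ∷ vs) es →
    Joins (ends f) (Vec.lookup (a ∷ vs) (fromℕ t)) a →
    ∀ i → Joins (ends (Vec.lookup (es ∷ʳ f) i)) (Vec.lookup (a ∷ vs) i) (Vec.lookup (a ∷ vs) (csuc i))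
  closed-path-joins {t} {es = es} f path closing i with Top.view i
  ... | Top.‵fromℕ     rewrite lookup-∷ʳ-fromℕ es f | csuc-fromℕ t = closing
  ... | Top.‵inject₁ j rewrite lookup-∷ʳ-inject₁ es f j | csuc-inject₁ j = path-joins path j

  closed-path-links-injective : ∀ {t} (vert : Fin (2 + t) → Fin n) (es : Vec Link (suc t)) f →
    Injective _≡_ _≡_ vert → (∀ i → Joins (ends (Vec.lookup (es ∷ʳ f) i)) (vert i) (vert (csuc i))) →
    f ≢ Vec.head es → Injective _≡_ _≡_ (Vec.lookup (es ∷ʳ f))
  closed-path-links-injective {zero} _ (e ∷ []) f _ _ f≢e {zero}     {zero}     _   = refl
  closed-path-links-injective {zero} _ (e ∷ []) f _ _ f≢e {zero}     {suc zero} e≡f = ⊥-elim (f≢e (sym e≡f))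
  closed-path-links-injective {zero} _ (e ∷ []) f _ _ f≢e {suc zero} {zero}     f≡e = ⊥-elim (f≢e f≡e)
  closed-path-links-injective {zero} _ (e ∷ []) f _ _ f≢e {suc zero} {suc zero} _   = refl
  closed-path-links-injective {suc t} vert es f vert-injective adjacent _ =
    cycle-links-injective vert (Vec.lookup (es ∷ʳ f)) vert-injective adjacent

  close-path : ∀ {t a} {vs : Vec (Fin n) (suc t)} {es : Vec Link (suc t)} f →
    Path (a ∷ vs) es → Unique (a ∷ vs) → Joins (ends f) (Vec.lookup (a ∷ vs) (fromℕ (suc t))) a →
    f ≢ Vec.head es → Cycle G (suc t)
  close-path {a = a} {vs} {es} f path unique closing f≢e = record
    { vert     = Vec.lookup (a ∷ vs)
    ; edge     = Vec.lookup (es ∷ʳ f)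
    ; vertInj  = lookup-injective unique _ _
    ; edgeInj  = closed-path-links-injective (Vec.lookup (a ∷ vs)) es f
                                             (lookup-injective unique _ _) adjacent f≢e
    ; adjacent = adjacent
    }
    where
    adjacent : ∀ i → Joins (ends (Vec.lookup (es ∷ʳ f) i)) (Vec.lookup (a ∷ vs) i) (Vec.lookup (a ∷ vs) (csuc i))
    adjacent = closed-path-joins f path closing

  record InitialSegment {r} (vs : Vec (Fin n) (suc r)) (b : Fin n) : Set where
    field
      len      : ℕ
      verts    : Vec (Fin n) (suc len)
      steps    : Vec Link len
      isPath   : Path verts steps
      isUnique : Unique verts
      starts   : Vec.head verts ≡ Vec.head vs
      stops    : Vec.lookup verts (fromℕ len) ≡ b
      len≤     : len ≤ r
      ⊆        : ∀ {c} → c ∈ verts → c ∈ vs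

  initialSegment : ∀ {r b} {vs : Vec (Fin n) (suc r)} {es} → Path vs es → Unique vs → b ∈ vs →
                   InitialSegment vs b
  initialSegment {vs = v ∷ _} _ _ (here b≡v) = record
    { len = 0 ; verts = v ∷ [] ; steps = [] ; isPath = [] ; isUnique = [] ∷ []
    ; starts = refl ; stops = sym b≡v ; len≤ = z≤n
    ; ⊆ = λ { (here c≡v) → here c≡v ; (there ()) }
    }
  initialSegment {b = b} {vs = v ∷ vs} (joins ∷ path) (v∉ ∷ unique) (there b∈) = record
    { len      = suc (len S)
    ; verts    = v ∷ verts S
    ; steps    = _ ∷ steps S
    ; isPath   = subst (Joins _ v) (sym (starts S)) joins ∷ isPath S
    ; isUnique = ∉⇒All≢ (All≢⇒∉ v∉ ∘ ⊆ S) ∷ isUnique S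
    ; starts   = refl
    ; stops    = stops S
    ; len≤     = s≤s (len≤ S)
    ; ⊆        = λ { (here c≡v) → here c≡v ; (there c∈) → there (⊆ S c∈) }
    }
    where
    open InitialSegment
    S : InitialSegment vs b
    S = initialSegment path unique b∈

  -- The path holds the vertices of the walk so far, latest first. The first dart of the
  -- walk that returns to one of them closes the initial segment up to that vertex into a
  -- cycle; the segment is not a single backtracked link because the walk is non-backtracking.
  path+walk⇒cycle : ∀ {r a ds} {v : Fin n} {vs : Vec (Fin n) (suc r)} {e es} →
    Path (v ∷ vs) (e ∷ es) → Unique (v ∷ vs) → a ∈ vs → Walk v ds a → NonBacktracking (just e) ds →
    ∃ λ t → suc t ≤ suc r + length ds × Cycle G t
  path+walk⇒cycle _ (v∉ ∷ _) a∈ [] _ = ⊥-elim (All≢⇒∉ v∉ a∈)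
  path+walk⇒cycle {r} {v = v} {vs} path@(joins ∷ path′) unique@(v∉ ∷ unique′) a∈
                  (_∷_ {y = z} {ds} src w) (z≢e , nb) with target z ∈? (v ∷ vs)
  ... | yes (here z→v) = ⊥-elim (source≢target z (trans src (sym z→v)))
  ... | yes (there z∈) = len S , bound , close-path (link z) (isPath S) (isUnique S) closing z≢e
    where
    open InitialSegment
    S : InitialSegment (v ∷ vs) (target z)
    S = initialSegment (joins ∷ path′) (v∉ ∷ unique′) (there z∈)
    closing : Joins (ends (link z)) (Vec.lookup (verts S) (fromℕ (len S))) v
    closing = subst (λ b → Joins (ends (link z)) b v) (sym (stops S)) (reverse-joins z src)
    bound : suc (len S) ≤ suc r + suc (length ds)
    bound = subst (suc (len S) ≤_) (sym (+-suc (suc r) (length ds)))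
                  (s≤s (≤-trans (len≤ S) (m≤m+n (suc r) (length ds))))
  ... | no z∉
    with path+walk⇒cycle (reverse-joins z src ∷ path) (∉⇒All≢ z∉ ∷ unique) (there a∈) w nb
  ...   | t , short , cycle = t , subst (suc t ≤_) (sym (+-suc (suc r) (length ds))) short , cycle

  closed-walk⇒cycle : ∀ {a ds} → Walk a ds a → NonBacktracking nothing ds → 1 ≤ length ds →
                      ∃ λ t → suc t ≤ length ds × Cycle G t
  closed-walk⇒cycle {a} (_∷_ {y = y} src w) (_ , nb) _ =
    path+walk⇒cycle (reverse-joins y src ∷ []) ((target≢source ∷ []) ∷ [] ∷ []) (here refl) w nb
    where
    target≢source : target y ≢ a
    target≢source eq = source≢target y (trans src (sym eq))

  module _ {d : ℕ} (girth : GirthAtLeast (2 * d + 1) G) where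

    walksTo≤1 : ∀ v u → walksTo (suc d) v nothing u ≤ 1
    walksTo≤1 v u with 2 ≤? walksTo (suc d) v nothing u
    ... | no 2≰ = s≤s⁻¹ (≰⇒> 2≰)
    ... | yes 2≤ with 2≤walksTo⇒closedWalk d v nothing u 2≤
    ...   | _ , _ , w , nb , nonempty , short with closed-walk⇒cycle w nb nonempty
    ...     | t , t< , cycle =
      ⊥-elim (girth t (subst (suc (suc t) ≤_) (+-comm 1 (2 * d)) (s≤s (≤-trans t< short))) cycle)

    sum-walks≤n² : ∑[ v < n ] walks (suc d) v nothing ≤ n * n
    sum-walks≤n² = begin
      ∑[ v < n ] walks (suc d) v nothing
        ≡⟨ sum-cong-≗ {n} (λ v → sum-walksTo (suc d) v nothing) ⟨
      ∑[ v < n ] ∑[ u < n ] walksTo (suc d) v nothing u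
        ≤⟨ sum-mono-≤ (λ v → sum-mono-≤ (walksTo≤1 v)) ⟩
      ∑[ v < n ] ∑[ u < n ] 1
        ≡⟨ sum-cong-≗ {n} (λ v → trans (sum-const n 1) (*-identityʳ n)) ⟩
      ∑[ v < n ] n
        ≡⟨ sum-const n n ⟩
      n * n ∎
      where open ≤-Reasoning


moore-inequality : ∀ {n x s} (G : Multipole n) d → IsKGSMultipole (suc x) (2 * d + 1) s G →
                   moore (suc x) d * n ≤ n * n + s * arithmeticGeometric x d
moore-inequality {n} {x} {s} G d (regular , girth , semiedgeCount) = begin
  n + suc x * geometric x d * n
    ≤⟨ +-monoʳ-≤ n (dartWalks-lower G regular semiedgeCount d) ⟩
  n + (dartWalks G d + arithmeticGeometric x d * s)
    ≡⟨ +-assoc n (dartWalks G d) (arithmeticGeometric x d * s) ⟨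
  n + dartWalks G d + arithmeticGeometric x d * s
    ≡⟨ cong (_+ arithmeticGeometric x d * s) (sum-walks≡n+dartWalks G d) ⟨
  ∑[ v < n ] walks G (suc d) v nothing + arithmeticGeometric x d * s
    ≤⟨ +-monoˡ-≤ (arithmeticGeometric x d * s) (sum-walks≤n² G {d} girth) ⟩
  n * n + arithmeticGeometric x d * s
    ≡⟨ +-congˡ {n * n} (*-comm (arithmeticGeometric x d) s) ⟩
  n * n + s * arithmeticGeometric x d ∎
  where open ≤-Reasoning

-- From natural numbers to the rational statement

pos-^ : ∀ m d → + (m ^ d) ≡ (+ m) ℤ.^ d
pos-^ m zero    = refl
pos-^ m (suc d) = trans (ℤₚ.pos-* m (m ^ d)) (cong (λ i → + m ℤ.* i) (pos-^ m d))

pos-∸ : ∀ {m n} → n ≤ m → + m ℤ.- + n ≡ + (m ∸ n)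
pos-∸ {m} {n} n≤m = trans (ℤₚ.m-n≡m⊖n m n) (ℤₚ.⊖-≥ n≤m)

*-cancelˡ-/ : ∀ i m c → i ≡ + suc c ℤ.* + m → i / suc c ≡ + m / 1
*-cancelˡ-/ i m c i≡ = fromℚᵘ-cong {mkℚᵘ i c} {mkℚᵘ (+ m) 0}
  (*≡* (trans (ℤₚ.*-identityʳ i) (trans i≡ (ℤₚ.*-comm (+ suc c) (+ m)))))

Mkd≡moore : ∀ c d → Mkd (3 + c) d ≡ + moore (3 + c) d / 1
Mkd≡moore c d = *-cancelˡ-/ _ M c (begin
  + (3 + c) ℤ.* (+ (2 + c)) ℤ.^ d ℤ.- + 2  ≡⟨ cong (λ i → + (3 + c) ℤ.* i ℤ.- + 2) (pos-^ (2 + c) d) ⟨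
  + (3 + c) ℤ.* + ((2 + c) ^ d) ℤ.- + 2    ≡⟨ cong (λ i → i ℤ.- + 2) (ℤₚ.pos-* (3 + c) ((2 + c) ^ d)) ⟨
  + ((3 + c) * (2 + c) ^ d) ℤ.- + 2        ≡⟨ cong (λ m → + m ℤ.- + 2) (moore-closed (suc c) d) ⟩
  + (suc c * M + 2) ℤ.- + 2                ≡⟨ pos-∸ (m≤n+m 2 (suc c * M)) ⟩
  + (suc c * M + 2 ∸ 2)                    ≡⟨ cong +_ (m+n∸n≡m (suc c * M) 2) ⟩
  + (suc c * M)                            ≡⟨ ℤₚ.pos-* (suc c) M ⟩
  + suc c ℤ.* + M                          ∎)
  where
  open ≡-Reasoning
  M : ℕ
  M = moore (3 + c) d

-- suc (c + c * suc c) is suc c * suc c, the denominator of T (3 + c) d s.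
T≡s*arithmeticGeometric : ∀ c d s → T (3 + c) d s ≡ + (s * arithmeticGeometric (2 + c) d) / 1
T≡s*arithmeticGeometric c d s = *-cancelˡ-/ _ (s * a) (c + c * suc c) (begin
  + s ℤ.* ((+ (d * (2 + C)) ℤ.- + (2 * d) ℤ.- + 1) ℤ.* P) ℤ.+ + s
    ≡⟨ cong₂ (λ i j → + s ℤ.* ((i ℤ.- j ℤ.- + 1) ℤ.* P) ℤ.+ + s)
             (trans (ℤₚ.pos-* d (2 + C)) (cong (λ i → + d ℤ.* i) (ℤₚ.pos-+ 2 C))) (ℤₚ.pos-* 2 d) ⟩
  + s ℤ.* ((+ d ℤ.* (+ 2 ℤ.+ + C) ℤ.- + 2 ℤ.* + d ℤ.- + 1) ℤ.* P) ℤ.+ + s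
    ≡⟨ collect (+ s) (+ d) (+ C) P ⟩
  + s ℤ.* ((+ d ℤ.* + C ℤ.* P ℤ.+ + 1) ℤ.- P)
    ≡⟨ cong (λ i → + s ℤ.* (i ℤ.- P)) closed ⟨
  + s ℤ.* ((+ C ℤ.* + C ℤ.* + a ℤ.+ P) ℤ.- P)
    ≡⟨ cancel (+ s) (+ C) (+ a) P ⟩
  + C ℤ.* + C ℤ.* (+ s ℤ.* + a)
    ≡⟨ cong₂ ℤ._*_ (ℤₚ.pos-* C C) (ℤₚ.pos-* s a) ⟨
  + (C * C) ℤ.* + (s * a) ∎)
  where
  open ≡-Reasoning
  C a : ℕ
  C = suc c
  a = arithmeticGeometric (suc C) d
  P : ℤ.ℤ
  P = (+ suc C) ℤ.^ d
  closed : + C ℤ.* + C ℤ.* + a ℤ.+ P ≡ + d ℤ.* + C ℤ.* P ℤ.+ + 1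
  closed = begin
    + C ℤ.* + C ℤ.* + a ℤ.+ P
      ≡⟨ cong₂ ℤ._+_ (trans (ℤₚ.pos-* (C * C) a) (cong (ℤ._* + a) (ℤₚ.pos-* C C))) (pos-^ (suc C) d) ⟨
    + (C * C * a) ℤ.+ + (suc C ^ d)
      ≡⟨ ℤₚ.pos-+ (C * C * a) (suc C ^ d) ⟨
    + (C * C * a + suc C ^ d)
      ≡⟨ cong +_ (arithmeticGeometric-closed C d) ⟩
    + (d * C * suc C ^ d + 1)
      ≡⟨ ℤₚ.pos-+ (d * C * suc C ^ d) 1 ⟩
    + (d * C * suc C ^ d) ℤ.+ + 1
      ≡⟨ cong (ℤ._+ + 1) (trans (ℤₚ.pos-* (d * C) (suc C ^ d))
                                (cong₂ ℤ._*_ (ℤₚ.pos-* d C) (pos-^ (suc C) d))) ⟩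
    + d ℤ.* + C ℤ.* P ℤ.+ + 1 ∎
  collect : ∀ s d c p → s ℤ.* ((d ℤ.* (+ 2 ℤ.+ c) ℤ.- + 2 ℤ.* d ℤ.- + 1) ℤ.* p) ℤ.+ s
                        ≡ s ℤ.* ((d ℤ.* c ℤ.* p ℤ.+ + 1) ℤ.- p)
  collect = ℤ-Solver.solve-∀
  cancel : ∀ s c a p → s ℤ.* ((c ℤ.* c ℤ.* a ℤ.+ p) ℤ.- p) ≡ c ℤ.* c ℤ.* (s ℤ.* a)
  cancel = ℤ-Solver.solve-∀

0≤n²-Mn+S : ∀ n M S → M * n ≤ n * n + S →
            0ℚ ≤ℚ (((+ n / 1) *ℚ (+ n / 1)) -ℚ ((+ M / 1) *ℚ (+ n / 1))) +ℚ (+ S / 1)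
0≤n²-Mn+S n M S Mn≤ = toℚᵘ-cancel-≤ (ℚᵘₚ.≤-respʳ-≃ (ℚᵘₚ.≃-sym toℚᵘ≃X) (*≤* 0≤↥X))
  where
  ι : ℕ → ℚᵘ
  ι m = mkℚᵘ (+ m) 0
  X : ℚᵘ
  X = ((ι n ℚᵘ.* ι n) ℚᵘ.- (ι M ℚᵘ.* ι n)) ℚᵘ.+ ι S
  toℚᵘ-ι : ∀ m → toℚᵘ (+ m / 1) ℚᵘ.≃ ι m
  toℚᵘ-ι m = toℚᵘ-fromℚᵘ (ι m)
  toℚᵘ-ι* : ∀ m m′ → toℚᵘ ((+ m / 1) *ℚ (+ m′ / 1)) ℚᵘ.≃ ι m ℚᵘ.* ι m′
  toℚᵘ-ι* m m′ =
    ℚᵘₚ.≃-trans (toℚᵘ-homo-* (+ m / 1) (+ m′ / 1)) (ℚᵘₚ.*-cong (toℚᵘ-ι m) (toℚᵘ-ι m′))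
  toℚᵘ≃X : toℚᵘ ((((+ n / 1) *ℚ (+ n / 1)) -ℚ ((+ M / 1) *ℚ (+ n / 1))) +ℚ (+ S / 1)) ℚᵘ.≃ X
  toℚᵘ≃X =
    ℚᵘₚ.≃-trans (toℚᵘ-homo-+ (nn -ℚ Mn) (+ S / 1))
      (ℚᵘₚ.+-cong (ℚᵘₚ.≃-trans (toℚᵘ-homo-+ nn (Data.Rational.-_ Mn))
                               (ℚᵘₚ.+-cong (toℚᵘ-ι* n n) toℚᵘ-Mn))
                  (toℚᵘ-ι S))
    where
    toℚᵘ-Mn : toℚᵘ (Data.Rational.-_ ((+ M / 1) *ℚ (+ n / 1))) ℚᵘ.≃ ℚᵘ.- (ι M ℚᵘ.* ι n)
    toℚᵘ-Mn = ℚᵘₚ.≃-trans (toℚᵘ-homo‿- ((+ M / 1) *ℚ (+ n / 1))) (ℚᵘₚ.-‿cong (toℚᵘ-ι* M n))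
    nn Mn : ℚ
    nn = (+ n / 1) *ℚ (+ n / 1)
    Mn = (+ M / 1) *ℚ (+ n / 1)
  numerator : ∀ n M S → ((n ℤ.* n) ℤ.* + 1 ℤ.+ (ℤ.- (M ℤ.* n)) ℤ.* + 1) ℤ.* + 1 ℤ.+ S ℤ.* + 1
                        ≡ (n ℤ.* n ℤ.+ S) ℤ.- M ℤ.* n
  numerator = ℤ-Solver.solve-∀
  0≤↥X : 0ℤ ℤ.≤ ℚᵘ.↥ X ℤ.* + 1
  0≤↥X = subst (0ℤ ℤ.≤_) (sym (begin
    ℚᵘ.↥ X ℤ.* + 1                         ≡⟨ ℤₚ.*-identityʳ (ℚᵘ.↥ X) ⟩
    ℚᵘ.↥ X                                 ≡⟨ numerator (+ n) (+ M) (+ S) ⟩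
    (+ n ℤ.* + n ℤ.+ + S) ℤ.- + M ℤ.* + n  ≡⟨ cong₂ ℤ._-_ (trans (ℤₚ.pos-+ (n * n) S)
                                                                (cong (ℤ._+ + S) (ℤₚ.pos-* n n)))
                                                         (ℤₚ.pos-* M n) ⟨
    + (n * n + S) ℤ.- + (M * n)            ≡⟨ pos-∸ Mn≤ ⟩
    + (n * n + S ∸ M * n)                  ∎)) (ℤ.+≤+ z≤n)
    where open ≡-Reasoning

proposition2 : (k d s n : ℕ) → 3 ≤ k → 1 ≤ d → (G : Multipole n)
    → IsKGSMultipole k (2 * d + 1) s G
    → 0ℚ ≤ℚ (((+ n / 1) *ℚ (+ n / 1)) -ℚ (Mkd k d *ℚ (+ n / 1))) +ℚ T k d s
proposition2 (suc (suc (suc c))) d s n (s≤s (s≤s (s≤s _))) _ G multipole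
  rewrite Mkd≡moore c d | T≡s*arithmeticGeometric c d s =
  0≤n²-Mn+S n (moore (3 + c) d) (s * arithmeticGeometric (2 + c) d) (moore-inequality G d multipole)
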